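{- Let $q\geq 2$ be an integer and let $S=\langle n,n+1,\dots,n+t\rangle$ with integers $\lceil\frac{n-1}{2}\rceil\leq t<n$. Then $$GM_q(S)=qn+\left\lfloor\frac tq\right\rfloor-2\left\lceil\frac nq\right\rceil-\#A+3,$$ where $$A=\{k\in\mathbb Z: t<k\leq n-1,\ t\geq (k\bmod q),\ q\nmid k\}\cup\{k\in\mathbb Z: t<k\leq n-1,\ k\leq qt-n,\ q\mid (k+n),\ q\nmid k\}.$$
   Context: $\langle n,\dots,n+t\rangle$ is the set of $\mathbb N$-linear combinations of $n,\dots,n+t$. For integers $a$ and $b\geq1$, $a\bmod b$ denotes the remainder in $\{0,\dots,b-1\}$. Write $S^*=S\setminus\{0\}$, $qS^*+S=\{qx+y: x\in S^*,\ y\in S\}$, and $GM_q(S):=\#\big(S\setminus (qS^*+S)\big)+1$. -}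

module Defs where

open import Data.Nat using (ℕ; zero; suc; _+_; _*_; _∸_; _≤_; _<_; NonZero)
open import Data.Nat.DivMod using (_/_)
open import Data.Nat.Divisibility using (_∣_)
open import Data.Fin using (Fin; toℕ) renaming (zero to fzero; suc to fsuc)
open import Data.Sum using (_⊎_)
open import Data.Nat.DivMod using (_%_)
open import Data.Product using (Σ; _×_; ∃-syntax)
open import Data.List using (List; length)
open import Data.List.Membership.Propositional using (_∈_)
open import Data.List.Relation.Unary.Unique.Propositional using (Unique)
open import Relation.Nullary using (¬_)
open import Relation.Binary.PropositionalEquality using (_≡_; _≢_)
open import Function.Bundles using (_⇔_)

ΣFin : (m : ℕ) → (Fin m → ℕ) → ℕ
ΣFin zero f = 0
ΣFin (suc m) f = f fzero + ΣFin m (λ i → f (fsuc i))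

InS : (n t : ℕ) → ℕ → Set
InS n t x = Σ (Fin (suc t) → ℕ) λ c → x ≡ ΣFin (suc t) (λ i → c i * (n + toℕ i))

InS* : (n t : ℕ) → ℕ → Set
InS* n t x = InS n t x × x ≢ 0

InQS*+S : (q n t : ℕ) → ℕ → Set
InQS*+S q n t z = ∃[ x ] ∃[ y ] (InS* n t x × InS n t y × z ≡ q * x + y)

InGM : (q n t : ℕ) → ℕ → Set
InGM q n t z = InS n t z × ¬ InQS*+S q n t z

HasSize : (ℕ → Set) → ℕ → Set
HasSize P m = Σ (List ℕ) λ xs → Unique xs × (length xs ≡ m) × (∀ x → (x ∈ xs) ⇔ P x)

-- the set A of the corollary (elements k are integers with k > t ≥ 0, so k ∈ ℕ)
InA : (q n t : ℕ) → .{{NonZero q}} → ℕ → Set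
InA q n t k =
  (t < k × k ≤ n ∸ 1 × (k % q) ≤ t × ¬ (q ∣ k))
  ⊎
  (t < k × k ≤ n ∸ 1 × k + n ≤ q * t × q ∣ (k + n) × ¬ (q ∣ k))

⌈_/_⌉ : ℕ → (b : ℕ) → .{{NonZero b}} → ℕ
⌈ a / b ⌉ = (a + (b ∸ 1)) / b

module Submission where

-- Since n ≤ 2t + 1, the semigroup S is {0} ∪ [n, n + t] ∪ [2n, ∞). Sorting z = q x + y (x ∈ S*, y ∈ S)
-- by the shape of x and y shows that q S* + S consists of the multiples of q in [qn, qn + n), the
-- numbers qn + n + k (k < n) with k mod q ≤ t or with q ∣ k + n ≤ qt, and everything from qn + 2n on.
-- Hence S ∖ (q S* + S) is {0}, [n, n + t], [2n, qn), the non-multiples of q in [qn, qn + n) and the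
-- remaining qn + n + k. Counting the multiples of q below n and below t + 1 yields ⌈n/q⌉ and ⌊t/q⌋,
-- and the k ∈ (t, n) of either kind that are not multiples of q form A.

open import Defs
open import Data.Nat
open import Data.Nat.Properties
open import Data.Nat.DivMod
open import Data.Nat.Divisibility
  using (_∣_; _∣?_; divides; ∣-refl; ∣⇒≤; m∣m*n; ∣m∣n⇒∣m+n; ∣m+n∣m⇒∣n; n∣m⇒m%n≡0)
open import Data.Nat.Induction using (<-rec)
open import Data.Nat.Tactic.RingSolver using (solve-∀)
open import Data.Fin using (Fin; toℕ; fromℕ<) renaming (zero to fzero; suc to fsuc)
open import Data.Fin.Properties using (toℕ<n; toℕ-fromℕ<)
open import Data.List using (List; []; _∷_; _++_; length; filter)
open import Data.List.Properties using (length-++; filter-++; filter-all; filter-none)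
open import Data.List.Membership.Propositional using (_∈_)
open import Data.List.Membership.Propositional.Properties using (∈-filter⁺; ∈-filter⁻)
open import Data.List.Relation.Unary.Any using (here; there)
open import Data.List.Relation.Unary.All as All using (All)
open import Data.List.Relation.Unary.AllPairs using ([]; _∷_)
open import Data.List.Relation.Unary.Unique.Propositional using (Unique)
open import Data.List.Relation.Unary.Unique.Propositional.Properties using (filter⁺)
open import Data.Empty using (⊥-elim)
open import Data.Product using (∃-syntax; _×_; _,_; proj₁; proj₂; uncurry)
open import Data.Sum using (_⊎_; inj₁; inj₂; [_,_]′)
open import Function using (_∘′_)
open import Function.Bundles using (_⇔_; mk⇔; Equivalence)
open import Function.Properties.Equivalence using () renaming (trans to ⇔-trans; sym to ⇔-sym)
open import Relation.Nullary using (¬_; yes; no; contradiction)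
open import Relation.Nullary.Decidable using (_×-dec_; _⊎-dec_; ¬?)
open import Relation.Unary using (Decidable)
open import Relation.Unary.Properties using (∁?)
open import Relation.Binary.PropositionalEquality
open import Algebra.Properties.CommutativeSemigroup +-commutativeSemigroup using (interchange)

interval : ℕ → ℕ → List ℕ
interval a zero = []
interval a (suc l) = a ∷ interval (suc a) l

∈-interval⁻ : ∀ {a l k} → k ∈ interval a l → a ≤ k × k < a + l
∈-interval⁻ {a} {suc l} (here refl) = ≤-refl , m<m+n a z<s
∈-interval⁻ {a} {suc l} {k} (there k∈) with a<k , k< ← ∈-interval⁻ k∈ =
  <⇒≤ a<k , subst (k <_) (sym (+-suc a l)) k<

∈-interval⁺ : ∀ {a l k} → a ≤ k → k < a + l → k ∈ interval a l
∈-interval⁺ {a} {zero} a≤k k< = contradiction (≤-<-trans a≤k k<) (<-irrefl (sym (+-identityʳ a)))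
∈-interval⁺ {a} {suc l} {k} a≤k k< with m≤n⇒m<n∨m≡n a≤k
... | inj₂ refl = here refl
... | inj₁ a<k = there (∈-interval⁺ a<k (subst (k <_) (+-suc a l) k<))

interval-unique : ∀ a l → Unique (interval a l)
interval-unique a zero = []
interval-unique a (suc l) =
  All.tabulate (λ k∈ → <⇒≢ (proj₁ (∈-interval⁻ k∈))) ∷ interval-unique (suc a) l

length-interval : ∀ a l → length (interval a l) ≡ l
length-interval a zero = refl
length-interval a (suc l) = cong suc (length-interval (suc a) l)

interval-++ : ∀ a l m → interval a (l + m) ≡ interval a l ++ interval (a + l) m
interval-++ a zero m = cong (λ b → interval b m) (sym (+-identityʳ a))
interval-++ a (suc l) m =
  cong (a ∷_) (trans (interval-++ (suc a) l m) (cong (λ b → interval (suc a) l ++ interval b m) (sym (+-suc a l))))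

range : ℕ → ℕ → List ℕ
range a b = interval a (b ∸ a)

∈-range⁻ : ∀ {a b k} → k ∈ range a b → a ≤ k × k < b
∈-range⁻ {a} {b} {k} k∈ with ∈-interval⁻ k∈ | a ≤? b
... | a≤k , k< | yes a≤b = a≤k , subst (k <_) (m+[n∸m]≡n a≤b) k<
... | a≤k , k< | no a≰b = contradiction (≤-<-trans a≤k (subst (λ d → k < a + d) b∸a≡0 k<))
                                       (<-irrefl (sym (+-identityʳ a)))
  where b∸a≡0 = m≤n⇒m∸n≡0 (<⇒≤ (≰⇒> a≰b))

∈-range⁺ : ∀ {a b k} → a ≤ k → k < b → k ∈ range a b
∈-range⁺ {a} {b} {k} a≤k k<b =
  ∈-interval⁺ a≤k (subst (k <_) (sym (m+[n∸m]≡n (≤-trans a≤k (<⇒≤ k<b)))) k<b)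

range-++ : ∀ {a b c} → a ≤ b → b ≤ c → range a c ≡ range a b ++ range b c
range-++ {a} {b} {c} a≤b b≤c = begin
  interval a (c ∸ a)                                   ≡⟨ cong (interval a) c∸a≡ ⟩
  interval a ((b ∸ a) + (c ∸ b))                       ≡⟨ interval-++ a (b ∸ a) (c ∸ b) ⟩
  interval a (b ∸ a) ++ interval (a + (b ∸ a)) (c ∸ b)
    ≡⟨ cong (λ x → range a b ++ interval x (c ∸ b)) (m+[n∸m]≡n a≤b) ⟩
  range a b ++ range b c                               ∎
  where
  open ≡-Reasoning
  c∸a≡ : c ∸ a ≡ (b ∸ a) + (c ∸ b)
  c∸a≡ = begin
    c ∸ a                   ≡⟨ cong (_∸ a) (sym (m+[n∸m]≡n b≤c)) ⟩
    (b + (c ∸ b)) ∸ a       ≡⟨ +-∸-comm (c ∸ b) a≤b ⟩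
    (b ∸ a) + (c ∸ b)       ∎

count : {P : ℕ → Set} → Decidable P → ℕ → ℕ → ℕ
count P? a b = length (filter P? (range a b))

module _ {P : ℕ → Set} (P? : Decidable P) where

  count-hasSize : ∀ b → (∀ k → P k → k < b) → HasSize P (count P? 0 b)
  count-hasSize b bounded = filter P? (range 0 b) , filter⁺ P? {range 0 b} (interval-unique 0 b) , refl ,
    λ k → mk⇔ (λ k∈ → proj₂ (∈-filter⁻ P? {xs = range 0 b} k∈))
              (λ Pk → ∈-filter⁺ P? (∈-range⁺ z≤n (bounded k Pk)) Pk)

  count-split : ∀ {a b c} → a ≤ b → b ≤ c → count P? a c ≡ count P? a b + count P? b c
  count-split {a} {b} {c} a≤b b≤c = begin
    length (filter P? (range a c))                        ≡⟨ cong (length ∘′ filter P?) (range-++ a≤b b≤c) ⟩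
    length (filter P? (range a b ++ range b c))           ≡⟨ cong length (filter-++ P? (range a b) (range b c)) ⟩
    length (filter P? (range a b) ++ filter P? (range b c)) ≡⟨ length-++ (filter P? (range a b)) ⟩
    count P? a b + count P? b c                           ∎
    where open ≡-Reasoning

  count-all : ∀ a b → (∀ k → a ≤ k → k < b → P k) → count P? a b ≡ b ∸ a
  count-all a b all = trans (cong length (filter-all P? (All.tabulate (λ k∈ → uncurry (all _) (∈-range⁻ k∈)))))
                            (length-interval a (b ∸ a))

  count-none : ∀ a b → (∀ k → a ≤ k → k < b → ¬ P k) → count P? a b ≡ 0
  count-none a b none = cong length (filter-none P? (All.tabulate (λ k∈ → uncurry (none _) (∈-range⁻ k∈))))

  count-skip : ∀ {a b c} → a ≤ b → b ≤ c → (∀ k → a ≤ k → k < b → ¬ P k) →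
               count P? a c ≡ count P? b c
  count-skip {a} {b} a≤b b≤c none = trans (count-split a≤b b≤c) (cong (_+ count P? b _) (count-none a b none))

  count-take : ∀ {a b c} → a ≤ b → b ≤ c → (∀ k → a ≤ k → k < b → P k) →
               count P? a c ≡ (b ∸ a) + count P? b c
  count-take {a} {b} a≤b b≤c all = trans (count-split a≤b b≤c) (cong (_+ count P? b _) (count-all a b all))

  count-complement : ∀ a b → count P? a b + count (∁? P?) a b ≡ b ∸ a
  count-complement a b = trans (length-filter-∁ (range a b)) (length-interval a (b ∸ a))
    where
    length-filter-∁ : ∀ xs → length (filter P? xs) + length (filter (∁? P?) xs) ≡ length xs
    length-filter-∁ [] = refl
    length-filter-∁ (x ∷ xs) with P? x
    ... | yes _ = cong suc (length-filter-∁ xs)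
    ... | no _ = trans (+-suc _ _) (cong suc (length-filter-∁ xs))

  module _ {Q : ℕ → Set} (Q? : Decidable Q) where

    count-shift : ∀ a b l → (∀ i → i < l → P (a + i) ⇔ Q (b + i)) → count P? a (a + l) ≡ count Q? b (b + l)
    count-shift a b l P⇔Q = begin
      length (filter P? (interval a (a + l ∸ a))) ≡⟨ cong (λ m → length (filter P? (interval a m))) (m+n∸m≡n a l) ⟩
      length (filter P? (interval a l))           ≡⟨ shift a b l P⇔Q ⟩
      length (filter Q? (interval b l))           ≡⟨ cong (λ m → length (filter Q? (interval b m))) (m+n∸m≡n b l) ⟨
      length (filter Q? (interval b (b + l ∸ b))) ∎
      where
      open ≡-Reasoning
      shift : ∀ a b l → (∀ i → i < l → P (a + i) ⇔ Q (b + i)) →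
              length (filter P? (interval a l)) ≡ length (filter Q? (interval b l))
      shift a b zero _ = refl
      shift a b (suc l) P⇔Q with P? a | Q? b | P⇔Q 0 z<s | shift (suc a) (suc b) l P⇔Q′
        where P⇔Q′ = λ i i<l → subst₂ (λ x y → P x ⇔ Q y) (+-suc a i) (+-suc b i) (P⇔Q (suc i) (s<s i<l))
      ... | yes _ | yes _ | _ | same-count = cong suc same-count
      ... | no _  | no _  | _ | same-count = same-count
      ... | yes p | no ¬q | e | _ =
        contradiction (subst Q (+-identityʳ b) (Equivalence.to e (subst P (sym (+-identityʳ a)) p))) ¬q
      ... | no ¬p | yes q | e | _ =
        contradiction (subst P (+-identityʳ a) (Equivalence.from e (subst Q (sym (+-identityʳ b)) q))) ¬p

    module _ {R : ℕ → Set} (R? : Decidable R) where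

      count-⊎ : ∀ a b → (∀ k → a ≤ k → k < b → (P k ⇔ (Q k ⊎ R k)) × ¬ (Q k × R k)) →
                count P? a b ≡ count Q? a b + count R? a b
      count-⊎ a b split = go (range a b) (λ k∈ → uncurry (split _) (∈-range⁻ k∈))
        where
        go : ∀ xs → (∀ {k} → k ∈ xs → (P k ⇔ (Q k ⊎ R k)) × ¬ (Q k × R k)) →
             length (filter P? xs) ≡ length (filter Q? xs) + length (filter R? xs)
        go [] _ = refl
        go (x ∷ xs) split with P? x | Q? x | R? x | split (here refl)
        ... | yes _ | yes _ | no _  | _ = cong suc (go xs (split ∘′ there))
        ... | yes _ | no _  | yes _ | _ = trans (cong suc (go xs (split ∘′ there))) (sym (+-suc _ _))
        ... | no _  | no _  | no _  | _ = go xs (split ∘′ there)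
        ... | _     | yes q | yes r | _ , disjoint = contradiction (q , r) disjoint
        ... | yes p | no ¬q | no ¬r | P⇔Q⊎R , _ = ⊥-elim ([ ¬q , ¬r ]′ (Equivalence.to P⇔Q⊎R p))
        ... | no ¬p | yes q | _     | P⇔Q⊎R , _ = contradiction (Equivalence.from P⇔Q⊎R (inj₁ q)) ¬p
        ... | no ¬p | no _  | yes r | P⇔Q⊎R , _ = contradiction (Equivalence.from P⇔Q⊎R (inj₂ r)) ¬p

HasSize-resp : {P Q : ℕ → Set} {m : ℕ} → (∀ x → P x ⇔ Q x) → HasSize P m → HasSize Q m
HasSize-resp P⇔Q (xs , unique , length≡ , ∈⇔P) = xs , unique , length≡ , λ x → ⇔-trans (∈⇔P x) (P⇔Q x)

ΣFin-zero : ∀ m → ΣFin m (λ _ → 0) ≡ 0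
ΣFin-zero zero = refl
ΣFin-zero (suc m) = ΣFin-zero m

ΣFin-cong : ∀ m {f g : Fin m → ℕ} → (∀ i → f i ≡ g i) → ΣFin m f ≡ ΣFin m g
ΣFin-cong zero _ = refl
ΣFin-cong (suc m) f≡g = cong₂ _+_ (f≡g fzero) (ΣFin-cong m (λ i → f≡g (fsuc i)))

ΣFin-+ : ∀ m (f g : Fin m → ℕ) → ΣFin m (λ i → f i + g i) ≡ ΣFin m f + ΣFin m g
ΣFin-+ zero f g = refl
ΣFin-+ (suc m) f g = trans (cong (f fzero + g fzero +_) (ΣFin-+ m (λ i → f (fsuc i)) (λ i → g (fsuc i))))
                           (interchange (f fzero) (g fzero) _ _)

ΣFin-*ʳ : ∀ m (f : Fin m → ℕ) k → ΣFin m (λ i → f i * k) ≡ ΣFin m f * k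
ΣFin-*ʳ zero f k = refl
ΣFin-*ʳ (suc m) f k = trans (cong (f fzero * k +_) (ΣFin-*ʳ m (λ i → f (fsuc i)) k))
                            (sym (*-distribʳ-+ k (f fzero) _))

ΣFin-mono-≤ : ∀ m {f g : Fin m → ℕ} → (∀ i → f i ≤ g i) → ΣFin m f ≤ ΣFin m g
ΣFin-mono-≤ zero _ = z≤n
ΣFin-mono-≤ (suc m) f≤g = +-mono-≤ (f≤g fzero) (ΣFin-mono-≤ m (λ i → f≤g (fsuc i)))

basis : ∀ {m} → Fin m → Fin m → ℕ
basis fzero fzero = 1
basis fzero (fsuc _) = 0
basis (fsuc _) fzero = 0
basis (fsuc j) (fsuc i) = basis j i

ΣFin-basis : ∀ m (j : Fin m) (w : Fin m → ℕ) → ΣFin m (λ i → basis j i * w i) ≡ w j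
ΣFin-basis (suc m) fzero w = trans (cong (1 * w fzero +_) (ΣFin-zero m)) (trans (+-identityʳ _) (*-identityˡ _))
ΣFin-basis (suc m) (fsuc j) w = ΣFin-basis m j (λ i → w (fsuc i))

module Semigroup (n t : ℕ) where

  InS′ : ℕ → Set
  InS′ z = z ≡ 0 ⊎ (n ≤ z × z ≤ n + t) ⊎ n + n ≤ z

  InS-0 : InS n t 0
  InS-0 = (λ _ → 0) , sym (ΣFin-zero (suc t))

  InS-+ : ∀ {x y} → InS n t x → InS n t y → InS n t (x + y)
  InS-+ {x} {y} (c , x≡) (d , y≡) = (λ i → c i + d i) , (begin
    x + y                                                    ≡⟨ cong₂ _+_ x≡ y≡ ⟩
    ΣFin (suc t) (λ i → c i * (n + toℕ i)) + ΣFin (suc t) (λ i → d i * (n + toℕ i))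
                                                             ≡⟨ ΣFin-+ (suc t) (λ i → c i * (n + toℕ i)) (λ i → d i * (n + toℕ i)) ⟨
    ΣFin (suc t) (λ i → c i * (n + toℕ i) + d i * (n + toℕ i)) ≡⟨ ΣFin-cong (suc t) (λ i → *-distribʳ-+ (n + toℕ i) (c i) (d i)) ⟨
    ΣFin (suc t) (λ i → (c i + d i) * (n + toℕ i))            ∎)
    where open ≡-Reasoning

  InS-generator : ∀ {j} → j ≤ t → InS n t (n + j)
  InS-generator {j} j≤t = basis (fromℕ< j<1+t) ,
    sym (trans (ΣFin-basis (suc t) (fromℕ< j<1+t) (λ i → n + toℕ i)) (cong (n +_) (toℕ-fromℕ< j<1+t)))
    where j<1+t : j < suc t
          j<1+t = s≤s j≤t

  generator-index : ∀ {x} → n ≤ x → x ≤ n + t → ∃[ i ] i ≤ t × x ≡ n + i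
  generator-index {x} n≤x x≤n+t =
    x ∸ n , subst (x ∸ n ≤_) (m+n∸m≡n n t) (∸-monoˡ-≤ n x≤n+t) , sym (m+[n∸m]≡n n≤x)

  InS-n : InS n t n
  InS-n = subst (InS n t) (+-identityʳ n) (InS-generator z≤n)

  InS′-of-sum : ∀ K {z} → K * n ≤ z → z ≤ K * (n + t) → InS′ z
  InS′-of-sum zero _ z≤0 = inj₁ (n≤0⇒n≡0 z≤0)
  InS′-of-sum (suc zero) {z} n≤z z≤ =
    inj₂ (inj₁ (subst (_≤ z) (+-identityʳ n) n≤z , subst (z ≤_) (+-identityʳ (n + t)) z≤))
  InS′-of-sum (suc (suc K)) Kn≤z _ = inj₂ (inj₂ (≤-trans (+-monoʳ-≤ n (m≤m+n n (K * n))) Kn≤z))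

  InS⇒InS′ : ∀ {z} → InS n t z → InS′ z
  InS⇒InS′ (c , refl) = InS′-of-sum (ΣFin (suc t) c) lower upper
    where
    z = ΣFin (suc t) (λ i → c i * (n + toℕ i))
    lower : ΣFin (suc t) c * n ≤ z
    lower = subst (_≤ z) (ΣFin-*ʳ (suc t) c n) (ΣFin-mono-≤ (suc t) (λ i → *-monoʳ-≤ (c i) (m≤m+n n (toℕ i))))
    upper : z ≤ ΣFin (suc t) c * (n + t)
    upper = subst (z ≤_) (ΣFin-*ʳ (suc t) c (n + t))
                  (ΣFin-mono-≤ (suc t) (λ i → *-monoʳ-≤ (c i) (+-monoʳ-≤ n (s≤s⁻¹ (toℕ<n i)))))

  InS-[2n,2n+2t] : ∀ {d} → d ≤ t + t → InS n t (n + n + d)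
  InS-[2n,2n+2t] {d} d≤2t with d ≤? t
  ... | yes d≤t = subst (InS n t) (rearrange n d) (InS-+ (InS-generator d≤t) InS-n)
    where rearrange : ∀ n d → n + d + n ≡ n + n + d
          rearrange = solve-∀
  ... | no d≰t = subst (InS n t) (trans (rearrange n t (d ∸ t)) (cong (n + n +_) (m+[n∸m]≡n t≤d)))
                       (InS-+ (InS-generator ≤-refl) (InS-generator d∸t≤t))
    where
    t≤d = <⇒≤ (≰⇒> d≰t)
    d∸t≤t = subst (d ∸ t ≤_) (m+n∸m≡n t t) (∸-monoˡ-≤ t d≤2t)
    rearrange : ∀ n t e → n + t + (n + e) ≡ n + n + (t + e)
    rearrange = solve-∀

  -- the blocks [k n, k (n + t)] overlap from k = 2 on because n ≤ 2t + 1
  InS-≥2n : 1 ≤ n → n ≤ suc (t + t) → ∀ d → InS n t (n + n + d)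
  InS-≥2n 1≤n n≤2t+1 = <-rec (λ d → InS n t (n + n + d)) step
    where
    step : ∀ d → (∀ {e} → e < d → InS n t (n + n + e)) → InS n t (n + n + d)
    step d below with d ≤? t + t
    ... | yes d≤2t = InS-[2n,2n+2t] d≤2t
    ... | no d≰2t = subst (InS n t) shift (InS-+ (below (∸-monoʳ-< 1≤n n≤d)) InS-n)
      where
      n≤d = ≤-trans n≤2t+1 (≰⇒> d≰2t)
      shift : n + n + (d ∸ n) + n ≡ n + n + d
      shift = trans (+-assoc (n + n) _ n) (cong (n + n +_) (m∸n+n≡m n≤d))

  InS′⇒InS : 1 ≤ n → n ≤ suc (t + t) → ∀ {z} → InS′ z → InS n t z
  InS′⇒InS _ _ (inj₁ refl) = InS-0
  InS′⇒InS _ _ (inj₂ (inj₁ (n≤z , z≤n+t)))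
    with i , i≤t , refl ← generator-index n≤z z≤n+t = InS-generator i≤t
  InS′⇒InS 1≤n n≤2t+1 (inj₂ (inj₂ 2n≤z)) = subst (InS n t) (m+[n∸m]≡n 2n≤z) (InS-≥2n 1≤n n≤2t+1 _)

module _ (q : ℕ) .{{_ : NonZero q}} where

  pred-q<q : pred q < q
  pred-q<q = subst (pred q <_) (suc-pred q) ≤-refl

  count-multiples-< : ∀ r → r < q → count (q ∣?_) 0 (suc r) ≡ 1
  count-multiples-< r r<q = trans (count-take (q ∣?_) z≤n (s≤s z≤n) (λ { .0 z≤n (s≤s z≤n) → divides 0 refl }))
                                  (cong suc (count-none (q ∣?_) 1 (suc r) no-multiple))
    where
    no-multiple : ∀ k → 1 ≤ k → k < suc r → ¬ q ∣ k
    no-multiple (suc k) _ k<1+r q∣k = <⇒≱ (≤-<-trans (s≤s⁻¹ k<1+r) r<q) (∣⇒≤ q∣k)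

  count-multiples-block : ∀ a r → r < q → count (q ∣?_) 0 (a * q + suc r) ≡ suc a
  count-multiples-block zero r r<q = count-multiples-< r r<q
  count-multiples-block (suc a) r r<q = begin
    count (q ∣?_) 0 (q + a * q + suc r)            ≡⟨ cong (count (q ∣?_) 0) (+-assoc q (a * q) (suc r)) ⟩
    count (q ∣?_) 0 (q + m)                        ≡⟨ count-split (q ∣?_) z≤n (m≤m+n q m) ⟩
    count (q ∣?_) 0 q + count (q ∣?_) q (q + m)
      ≡⟨ cong₂ _+_ one-below-q (count-shift (q ∣?_) (q ∣?_) q 0 m shift-by-q) ⟩
    1 + count (q ∣?_) 0 m                          ≡⟨ cong suc (count-multiples-block a r r<q) ⟩
    suc (suc a)                                    ∎
    where
    open ≡-Reasoning
    m = a * q + suc r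
    one-below-q : count (q ∣?_) 0 q ≡ 1
    one-below-q = subst (λ b → count (q ∣?_) 0 b ≡ 1) (suc-pred q) (count-multiples-< (pred q) pred-q<q)
    shift-by-q : ∀ i → i < m → q ∣ q + i ⇔ q ∣ i
    shift-by-q i _ = mk⇔ (λ q∣q+i → ∣m+n∣m⇒∣n q∣q+i ∣-refl) (∣m∣n⇒∣m+n ∣-refl)

  count-multiples-suc : ∀ m → count (q ∣?_) 0 (suc m) ≡ suc (m / q)
  count-multiples-suc m = subst (λ b → count (q ∣?_) 0 b ≡ suc (m / q)) (sym 1+m≡)
                      (count-multiples-block (m / q) (m % q) (m%n<n m q))
    where
    1+m≡ : suc m ≡ m / q * q + suc (m % q)
    1+m≡ = trans (cong suc (trans (m≡m%n+[m/n]*n m q) (+-comm (m % q) _))) (sym (+-suc _ _))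

  ⌈[1+m]/q⌉≡1+m/q : ∀ m → ⌈ suc m / q ⌉ ≡ suc (m / q)
  ⌈[1+m]/q⌉≡1+m/q m = begin
    (suc m + pred q) / q ≡⟨ cong (_/ q) (trans (sym (+-suc m (pred q))) (cong (m +_) (suc-pred q))) ⟩
    (m + q) / q          ≡⟨ +-distrib-/-∣ʳ m ∣-refl ⟩
    m / q + q / q        ≡⟨ cong (m / q +_) (n/n≡1 q) ⟩
    m / q + 1            ≡⟨ +-comm (m / q) 1 ⟩
    suc (m / q)          ∎
    where open ≡-Reasoning

  count-multiples : ∀ m → count (q ∣?_) 0 m ≡ ⌈ m / q ⌉
  count-multiples zero = sym (m<n⇒m/n≡0 pred-q<q)
  count-multiples (suc m) = trans (count-multiples-suc m) (sym (⌈[1+m]/q⌉≡1+m/q m))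

module GapCount (q n t : ℕ) .{{_ : NonZero q}} (2≤q : 2 ≤ q) (n≤2t+1 : n ≤ suc (t + t)) (t<n : t < n) where

  open Semigroup n t

  1≤n : 1 ≤ n
  1≤n = ≤-<-trans z≤n t<n

  2n≤qn : n + n ≤ q * n
  2n≤qn = subst (_≤ q * n) (cong (n +_) (+-identityʳ n)) (*-monoˡ-≤ n 2≤q)

  n≤[1+t]q : n ≤ suc t * q
  n≤[1+t]q = begin
    n                  ≤⟨ n≤2t+1 ⟩
    suc (t + t)        ≤⟨ n≤1+n _ ⟩
    suc (suc (t + t))  ≡⟨ double-suc t ⟩
    2 * suc t          ≤⟨ *-monoˡ-≤ (suc t) 2≤q ⟩
    q * suc t          ≡⟨ *-comm q (suc t) ⟩
    suc t * q          ∎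
    where
    open ≤-Reasoning
    double-suc : ∀ t → suc (suc (t + t)) ≡ 2 * suc t
    double-suc = solve-∀

  S*-generator : ∀ {i} → i ≤ t → InS* n t (n + i)
  S*-generator i≤t = InS-generator i≤t , λ n+i≡0 → contradiction (m+n≡0⇒m≡0 n n+i≡0) (n>0⇒n≢0 1≤n)

  -- for k < n, q n + n + k ∈ q S* + S exactly when Covered k
  Covered : ℕ → Set
  Covered k = k % q ≤ t ⊎ (k + n ≤ q * t × q ∣ k + n)

  Covered? : Decidable Covered
  Covered? k = (k % q ≤? t) ⊎-dec ((k + n ≤? q * t) ×-dec (q ∣? k + n))

  InQS*+S′ : ℕ → Set
  InQS*+S′ z = (q * n ≤ z × z < q * n + n × q ∣ z)
             ⊎ (q * n + n ≤ z × Covered (z ∸ (q * n + n)))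
             ⊎ q * n + n + n ≤ z

  InQS*+S′? : Decidable InQS*+S′
  InQS*+S′? z = ((q * n ≤? z) ×-dec ((z <? q * n + n) ×-dec (q ∣? z)))
              ⊎-dec ((q * n + n ≤? z) ×-dec Covered? (z ∸ (q * n + n)))
              ⊎-dec (q * n + n + n ≤? z)

  Covered⇒InQS*+S′ : ∀ {k} → Covered k → InQS*+S′ (q * n + n + k)
  Covered⇒InQS*+S′ {k} covered = inj₂ (inj₁ (m≤m+n _ k , subst Covered (sym (m+n∸m≡n (q * n + n) k)) covered))

  q*generator : ∀ {i} → i ≤ t → InQS*+S′ (q * (n + i) + 0)
  q*generator {i} i≤t rewrite +-identityʳ (q * (n + i)) | *-distribˡ-+ q n i with n ≤? q * i
  ... | no qi≱n = inj₁ (m≤m+n (q * n) (q * i) , +-monoʳ-< (q * n) (≰⇒> qi≱n) , ∣m∣n⇒∣m+n (m∣m*n n) (m∣m*n i))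
  ... | yes n≤qi = subst InQS*+S′ (trans (+-assoc (q * n) n _) (cong (q * n +_) (m+[n∸m]≡n n≤qi)))
                         (Covered⇒InQS*+S′ (inj₂ (subst (_≤ q * t) (sym k+n≡qi) (*-monoʳ-≤ q i≤t) ,
                                                  subst (q ∣_) (sym k+n≡qi) (m∣m*n i))))
    where k+n≡qi = m∸n+n≡m n≤qi

  q*generator+generator : ∀ {i j} → j ≤ t → InQS*+S′ (q * (n + i) + (n + j))
  q*generator+generator {i} {j} j≤t = subst InQS*+S′ (rearrange q n i j)
    (Covered⇒InQS*+S′ (inj₁ (≤-trans (≤-reflexive ([m+kn]%n≡m%n j i q)) (≤-trans (m%n≤m j q) j≤t))))
    where rearrange : ∀ q n i j → q * n + n + (j + i * q) ≡ q * (n + i) + (n + j)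
          rearrange = solve-∀

  qS*+S⇒InQS*+S′ : ∀ {z} → InQS*+S q n t z → InQS*+S′ z
  qS*+S⇒InQS*+S′ (x , y , (Sx , x≢0) , Sy , refl) with InS⇒InS′ Sx | InS⇒InS′ Sy
  ... | inj₁ x≡0 | _ = contradiction x≡0 x≢0
  ... | inj₂ (inj₂ 2n≤x) | _ = inj₂ (inj₂ (≤-trans (≤-trans qn+2n≤2qn (*-monoʳ-≤ q 2n≤x)) (m≤m+n (q * x) y)))
    where qn+2n≤2qn : q * n + n + n ≤ q * (n + n)
          qn+2n≤2qn = subst₂ _≤_ (sym (+-assoc (q * n) n n)) (sym (*-distribˡ-+ q n n)) (+-monoʳ-≤ (q * n) 2n≤qn)
  ... | inj₂ (inj₁ (n≤x , _)) | inj₂ (inj₂ 2n≤y) =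
    inj₂ (inj₂ (subst (_≤ q * x + y) (sym (+-assoc (q * n) n n)) (+-mono-≤ (*-monoʳ-≤ q n≤x) 2n≤y)))
  ... | inj₂ (inj₁ (n≤x , x≤n+t)) | inj₁ refl
    with i , i≤t , refl ← generator-index n≤x x≤n+t = q*generator i≤t
  ... | inj₂ (inj₁ (n≤x , x≤n+t)) | inj₂ (inj₁ (n≤y , y≤n+t))
    with i , _ , refl ← generator-index n≤x x≤n+t | j , j≤t , refl ← generator-index n≤y y≤n+t =
      q*generator+generator j≤t

  Covered⇒qS*+S : ∀ {k} → k < n → Covered k → InQS*+S q n t (q * n + n + k)
  Covered⇒qS*+S {k} k<n (inj₁ k%q≤t) =
    n + k / q , n + k % q , S*-generator k/q≤t , InS-generator k%q≤t , rearrange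
    where
    k/q≤t = s≤s⁻¹ (m<n*o⇒m/o<n (<-≤-trans k<n n≤[1+t]q))
    rearrange : q * n + n + k ≡ q * (n + k / q) + (n + k % q)
    rearrange = trans (cong (q * n + n +_) (trans (m≡m%n+[m/n]*n k q) (+-comm (k % q) _))) (shuffle q n (k / q) (k % q))
      where shuffle : ∀ q n a b → q * n + n + (a * q + b) ≡ q * (n + a) + (n + b)
            shuffle = solve-∀
  Covered⇒qS*+S {k} k<n (inj₂ (k+n≤qt , divides w k+n≡wq)) = n + w , 0 , S*-generator w≤t , InS-0 , rearrange
    where
    w≤t = *-cancelʳ-≤ w t q (subst₂ _≤_ k+n≡wq (*-comm q t) k+n≤qt)
    rearrange : q * n + n + k ≡ q * (n + w) + 0
    rearrange = begin
      q * n + n + k   ≡⟨ trans (+-assoc (q * n) n k) (cong (q * n +_) (+-comm n k)) ⟩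
      q * n + (k + n) ≡⟨ cong (q * n +_) k+n≡wq ⟩
      q * n + w * q   ≡⟨ cong (q * n +_) (*-comm w q) ⟩
      q * n + q * w   ≡⟨ sym (trans (+-identityʳ _) (*-distribˡ-+ q n w)) ⟩
      q * (n + w) + 0 ∎
      where open ≡-Reasoning

  ≥qn+2n⇒qS*+S : ∀ {z} → q * n + n + n ≤ z → InQS*+S q n t z
  ≥qn+2n⇒qS*+S {z} qn+2n≤z = n , z ∸ q * n , (subst (InS* n t) (+-identityʳ n) (S*-generator z≤n)) ,
    InS′⇒InS 1≤n n≤2t+1 (inj₂ (inj₂ 2n≤z∸qn)) , sym (m+[n∸m]≡n qn≤z)
    where
    qn≤z = ≤-trans (≤-trans (m≤m+n (q * n) n) (m≤m+n (q * n + n) n)) qn+2n≤z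
    2n≤z∸qn = subst (_≤ z ∸ q * n) (trans (cong (_∸ q * n) (+-assoc (q * n) n n)) (m+n∸m≡n (q * n) (n + n)))
                    (∸-monoˡ-≤ (q * n) qn+2n≤z)

  InQS*+S′⇒qS*+S : ∀ {z} → InQS*+S′ z → InQS*+S q n t z
  InQS*+S′⇒qS*+S (inj₁ (qn≤z , z<qn+n , divides w refl)) =
    w , 0 , (InS′⇒InS 1≤n n≤2t+1 (inj₂ (inj₁ (n≤w , w≤n+t))) , w≢0) , InS-0 , z≡
    where
    n≤w = *-cancelʳ-≤ n w q (subst (_≤ w * q) (*-comm q n) qn≤z)
    qn+n≤[n+1+t]q : q * n + n ≤ suc (n + t) * q
    qn+n≤[n+1+t]q = subst (q * n + n ≤_) (rearrange q n t) (+-monoʳ-≤ (q * n) n≤[1+t]q)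
      where rearrange : ∀ q n t → q * n + suc t * q ≡ suc (n + t) * q
            rearrange = solve-∀
    w≤n+t = s≤s⁻¹ (*-cancelʳ-< q w (suc (n + t)) (<-≤-trans z<qn+n qn+n≤[n+1+t]q))
    w≢0 = λ w≡0 → contradiction (subst (n ≤_) w≡0 n≤w) (<⇒≱ 1≤n)
    z≡ = trans (*-comm w q) (sym (+-identityʳ _))
  InQS*+S′⇒qS*+S {z} (inj₂ (inj₁ (qn+n≤z , covered))) with z <? q * n + n + n
  ... | yes z<qn+2n = subst (InQS*+S q n t) (m+[n∸m]≡n qn+n≤z) (Covered⇒qS*+S k<n covered)
    where k<n = +-cancelˡ-< (q * n + n) _ n (subst (_< q * n + n + n) (sym (m+[n∸m]≡n qn+n≤z)) z<qn+2n)
  ... | no z≮qn+2n = ≥qn+2n⇒qS*+S (≮⇒≥ z≮qn+2n)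
  InQS*+S′⇒qS*+S (inj₂ (inj₂ qn+2n≤z)) = ≥qn+2n⇒qS*+S qn+2n≤z

  InS′? : Decidable InS′
  InS′? z = (z ≟ 0) ⊎-dec ((n ≤? z) ×-dec (z ≤? n + t)) ⊎-dec (n + n ≤? z)

  InGM′ : ℕ → Set
  InGM′ z = InS′ z × ¬ InQS*+S′ z

  InGM′? : Decidable InGM′
  InGM′? z = InS′? z ×-dec ¬? (InQS*+S′? z)

  InGM⇔InGM′ : ∀ z → InGM q n t z ⇔ InGM′ z
  InGM⇔InGM′ z = mk⇔ (λ (Sz , ∉T) → InS⇒InS′ Sz , λ T′z → ∉T (InQS*+S′⇒qS*+S T′z))
                     (λ (S′z , ∉T′) → InS′⇒InS 1≤n n≤2t+1 S′z , λ Tz → ∉T′ (qS*+S⇒InQS*+S′ Tz))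

  bound : ℕ
  bound = q * n + n + n

  InGM′⇒<bound : ∀ z → InGM′ z → z < bound
  InGM′⇒<bound z (_ , ∉T′) = ≰⇒> (λ bound≤z → ∉T′ (inj₂ (inj₂ bound≤z)))

  ∉InQS*+S′-below-qn : ∀ {z} → z < q * n → ¬ InQS*+S′ z
  ∉InQS*+S′-below-qn z<qn (inj₁ (qn≤z , _)) = <⇒≱ z<qn qn≤z
  ∉InQS*+S′-below-qn z<qn (inj₂ (inj₁ (qn+n≤z , _))) = <⇒≱ z<qn (≤-trans (m≤m+n _ n) qn+n≤z)
  ∉InQS*+S′-below-qn z<qn (inj₂ (inj₂ bound≤z)) = <⇒≱ z<qn (≤-trans (≤-trans (m≤m+n _ n) (m≤m+n _ n)) bound≤z)

  InGM′[qn+i]⇔q∤i : ∀ i → i < n → InGM′ (q * n + i) ⇔ (¬ q ∣ i)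
  InGM′[qn+i]⇔q∤i i i<n = mk⇔
    (λ (_ , ∉T′) q∣i → ∉T′ (inj₁ (m≤m+n _ i , +-monoʳ-< (q * n) i<n , ∣m∣n⇒∣m+n (m∣m*n n) q∣i)))
    (λ q∤i → inj₂ (inj₂ (≤-trans 2n≤qn (m≤m+n _ i))) , λ
      { (inj₁ (_ , _ , q∣z)) → q∤i (∣m+n∣m⇒∣n q∣z (m∣m*n n))
      ; (inj₂ (inj₁ (qn+n≤z , _))) → <⇒≱ i<n (+-cancelˡ-≤ (q * n) n i qn+n≤z)
      ; (inj₂ (inj₂ bound≤z)) → <⇒≱ i<n (+-cancelˡ-≤ (q * n) n i (≤-trans (m≤m+n (q * n + n) n) bound≤z)) })

  InGM′[qn+n+i]⇔¬Covered : ∀ i → i < n → InGM′ (q * n + n + i) ⇔ (¬ Covered i)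
  InGM′[qn+n+i]⇔¬Covered i i<n = mk⇔
    (λ (_ , ∉T′) covered → ∉T′ (Covered⇒InQS*+S′ covered))
    (λ ¬covered → inj₂ (inj₂ (≤-trans 2n≤qn (≤-trans (m≤m+n _ n) (m≤m+n _ i)))) , λ
      { (inj₁ (_ , z<qn+n , _)) → <⇒≱ z<qn+n (m≤m+n _ i)
      ; (inj₂ (inj₁ (_ , covered))) → ¬covered (subst Covered (m+n∸m≡n (q * n + n) i) covered)
      ; (inj₂ (inj₂ bound≤z)) → <⇒≱ i<n (+-cancelˡ-≤ (q * n + n) n i bound≤z) })

  count-InGM′-from-qn : count InGM′? (q * n) bound ≡ count (∁? (q ∣?_)) 0 n + count (∁? Covered?) 0 n
  count-InGM′-from-qn = trans (count-split InGM′? (m≤m+n (q * n) n) (m≤m+n (q * n + n) n))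
    (cong₂ _+_ (count-shift InGM′? (∁? (q ∣?_)) (q * n) 0 n InGM′[qn+i]⇔q∤i)
               (count-shift InGM′? (∁? Covered?) (q * n + n) 0 n InGM′[qn+n+i]⇔¬Covered))

  count-InGM′-from-n : count InGM′? n bound ≡ suc t + ((q * n ∸ (n + n)) + count InGM′? (q * n) bound)
  count-InGM′-from-n = begin
    count InGM′? n bound
      ≡⟨ count-take InGM′? (m≤m+n n (suc t)) n+1+t≤bound generator∈GM′ ⟩
    (n + suc t ∸ n) + count InGM′? (n + suc t) bound
      ≡⟨ cong (_+ count InGM′? (n + suc t) bound) (m+n∸m≡n n (suc t)) ⟩
    suc t + count InGM′? (n + suc t) bound
      ≡⟨ cong (suc t +_) (count-skip InGM′? n+1+t≤2n 2n≤bound gap∉GM′) ⟩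
    suc t + count InGM′? (n + n) bound
      ≡⟨ cong (suc t +_) (count-take InGM′? 2n≤qn qn≤bound below-qn∈GM′) ⟩
    suc t + ((q * n ∸ (n + n)) + count InGM′? (q * n) bound)
      ∎
    where
    open ≡-Reasoning
    qn≤bound = ≤-trans (m≤m+n (q * n) n) (m≤m+n (q * n + n) n)
    2n≤bound = ≤-trans 2n≤qn qn≤bound
    n+1+t≤2n = +-monoʳ-≤ n t<n
    n+1+t≤bound = ≤-trans n+1+t≤2n 2n≤bound
    generator∈GM′ : ∀ k → n ≤ k → k < n + suc t → InGM′ k
    generator∈GM′ k n≤k k<n+1+t = inj₂ (inj₁ (n≤k , s≤s⁻¹ (subst (k <_) (+-suc n t) k<n+1+t))) ,
                             ∉InQS*+S′-below-qn (<-≤-trans k<n+1+t (≤-trans n+1+t≤2n 2n≤qn))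
    gap∉GM′ : ∀ k → n + suc t ≤ k → k < n + n → ¬ InGM′ k
    gap∉GM′ k n+1+t≤k k<2n (inj₁ refl , _) = <⇒≱ (<-≤-trans (m<m+n n z<s) n+1+t≤k) z≤n
    gap∉GM′ k n+1+t≤k k<2n (inj₂ (inj₁ (_ , k≤n+t)) , _) = <⇒≱ (subst (_≤ k) (+-suc n t) n+1+t≤k) k≤n+t
    gap∉GM′ k n+1+t≤k k<2n (inj₂ (inj₂ 2n≤k) , _) = <⇒≱ k<2n 2n≤k
    below-qn∈GM′ : ∀ k → n + n ≤ k → k < q * n → InGM′ k
    below-qn∈GM′ k 2n≤k k<qn = inj₂ (inj₂ 2n≤k) , ∉InQS*+S′-below-qn k<qn

  count-InGM′ : count InGM′? 0 bound ≡ 1 + count InGM′? n bound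
  count-InGM′ = trans (count-take InGM′? z≤n 1≤bound 0∈GM′)
                      (cong suc (count-skip InGM′? 1≤n n≤bound below-n∉GM′))
    where
    n≤bound = ≤-trans (≤-trans (m≤m+n n n) 2n≤qn) (≤-trans (m≤m+n (q * n) n) (m≤m+n (q * n + n) n))
    1≤bound = ≤-trans 1≤n n≤bound
    0∈GM′ : ∀ k → 0 ≤ k → k < 1 → InGM′ k
    0∈GM′ .0 _ (s≤s z≤n) = inj₁ refl , ∉InQS*+S′-below-qn (≤-trans 1≤n (≤-trans (m≤m+n n n) 2n≤qn))
    below-n∉GM′ : ∀ k → 1 ≤ k → k < n → ¬ InGM′ k
    below-n∉GM′ k 1≤k _ (inj₁ refl , _) = <⇒≱ 1≤k z≤n
    below-n∉GM′ k _ k<n (inj₂ (inj₁ (n≤k , _)) , _) = <⇒≱ k<n n≤k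
    below-n∉GM′ k _ k<n (inj₂ (inj₂ 2n≤k) , _) = <⇒≱ k<n (≤-trans (m≤m+n n n) 2n≤k)

  InA? : Decidable (InA q n t)
  InA? k = ((t <? k) ×-dec ((k ≤? n ∸ 1) ×-dec ((k % q ≤? t) ×-dec ¬? (q ∣? k))))
         ⊎-dec ((t <? k) ×-dec ((k ≤? n ∸ 1) ×-dec ((k + n ≤? q * t) ×-dec ((q ∣? k + n) ×-dec ¬? (q ∣? k)))))

  InA⇒t<k : ∀ {k} → InA q n t k → t < k
  InA⇒t<k (inj₁ (t<k , _)) = t<k
  InA⇒t<k (inj₂ (t<k , _)) = t<k

  InA⇒k≤n∸1 : ∀ {k} → InA q n t k → k ≤ n ∸ 1
  InA⇒k≤n∸1 (inj₁ (_ , k≤n∸1 , _)) = k≤n∸1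
  InA⇒k≤n∸1 (inj₂ (_ , k≤n∸1 , _)) = k≤n∸1

  InA⇒k<n : ∀ k → InA q n t k → k < n
  InA⇒k<n k A∋k = ≤-trans (s≤s (InA⇒k≤n∸1 A∋k)) (≤-reflexive (suc-pred n {{>-nonZero 1≤n}}))

  count-InA : count InA? 0 n ≡ count InA? (suc t) n
  count-InA = count-skip InA? z≤n t<n (λ k _ k≤t A∋k → <⇒≱ (InA⇒t<k A∋k) (s≤s⁻¹ k≤t))

  Covered⇔∣⊎InA : ∀ k → suc t ≤ k → k < n → (Covered k ⇔ (q ∣ k ⊎ InA q n t k)) × ¬ (q ∣ k × InA q n t k)
  Covered⇔∣⊎InA k t<k k<n = mk⇔ to from , disjoint
    where
    to : Covered k → q ∣ k ⊎ InA q n t k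
    to covered with q ∣? k
    ... | yes q∣k = inj₁ q∣k
    to (inj₁ k%q≤t) | no q∤k = inj₂ (inj₁ (t<k , <⇒≤pred k<n , k%q≤t , q∤k))
    to (inj₂ (k+n≤qt , q∣k+n)) | no q∤k = inj₂ (inj₂ (t<k , <⇒≤pred k<n , k+n≤qt , q∣k+n , q∤k))
    from : q ∣ k ⊎ InA q n t k → Covered k
    from (inj₁ q∣k) = inj₁ (subst (_≤ t) (sym (n∣m⇒m%n≡0 k q q∣k)) z≤n)
    from (inj₂ (inj₁ (_ , _ , k%q≤t , _))) = inj₁ k%q≤t
    from (inj₂ (inj₂ (_ , _ , k+n≤qt , q∣k+n , _))) = inj₂ (k+n≤qt , q∣k+n)
    disjoint : ¬ (q ∣ k × InA q n t k)
    disjoint (q∣k , inj₁ (_ , _ , _ , q∤k)) = q∤k q∣k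
    disjoint (q∣k , inj₂ (_ , _ , _ , _ , q∤k)) = q∤k q∣k

  count-Covered : count Covered? 0 n ≡ suc t + (count (q ∣?_) (suc t) n + count InA? (suc t) n)
  count-Covered = trans (count-take Covered? z≤n t<n (λ k _ k≤t → inj₁ (≤-trans (m%n≤m k q) (s≤s⁻¹ k≤t))))
                        (cong (suc t +_) (count-⊎ Covered? (q ∣?_) InA? (suc t) n Covered⇔∣⊎InA))

  count-multiples-below-n : count (q ∣?_) 0 n ≡ suc (t / q) + count (q ∣?_) (suc t) n
  count-multiples-below-n = trans (count-split (q ∣?_) z≤n t<n)
                                  (cong (_+ count (q ∣?_) (suc t) n) (count-multiples-suc q t))

  gap-count : count InGM′? 0 bound + 1 + (2 * ⌈ n / q ⌉ + count InA? 0 n) ≡ q * n + t / q + 3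
  gap-count = begin
    count InGM′? 0 bound + 1 + (2 * ⌈ n / q ⌉ + count InA? 0 n)
      ≡⟨ cong₂ (λ g c → g + 1 + (2 * c + count InA? 0 n)) gm ⌈n/q⌉≡ ⟩
    1 + (suc t + (Q + (X + Y))) + 1 + (2 * (suc (t / q) + M) + count InA? 0 n)
      ≡⟨ cong (λ a → 1 + (suc t + (Q + (X + Y))) + 1 + (2 * (suc (t / q) + M) + a)) count-InA ⟩
    1 + (suc t + (Q + (X + Y))) + 1 + (2 * (suc (t / q) + M) + A)
      ≡⟨ regroup t Q X Y (t / q) M A ⟩
    Q + ((suc (t / q) + M + X) + (suc t + (M + A) + Y)) + t / q + 3
      ≡⟨ cong₂ (λ u v → Q + (u + v) + t / q + 3) multiples+X non-covered+Y ⟩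
    Q + (n + n) + t / q + 3
      ≡⟨ cong (λ m → m + t / q + 3) (m∸n+n≡m 2n≤qn) ⟩
    q * n + t / q + 3 ∎
    where
    open ≡-Reasoning
    Q = q * n ∸ (n + n)
    X = count (∁? (q ∣?_)) 0 n
    Y = count (∁? Covered?) 0 n
    M = count (q ∣?_) (suc t) n
    A = count InA? (suc t) n
    gm : count InGM′? 0 bound ≡ 1 + (suc t + (Q + (X + Y)))
    gm = trans count-InGM′ (cong suc (trans count-InGM′-from-n (cong (λ m → suc t + (Q + m)) count-InGM′-from-qn)))
    ⌈n/q⌉≡ : ⌈ n / q ⌉ ≡ suc (t / q) + M
    ⌈n/q⌉≡ = trans (sym (count-multiples q n)) count-multiples-below-n
    multiples+X : suc (t / q) + M + X ≡ n
    multiples+X = trans (cong (_+ X) (sym count-multiples-below-n)) (count-complement (q ∣?_) 0 n)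
    non-covered+Y : suc t + (M + A) + Y ≡ n
    non-covered+Y = trans (cong (_+ Y) (sym count-Covered)) (count-complement Covered? 0 n)
    regroup : ∀ t Q X Y tq M A → 1 + (suc t + (Q + (X + Y))) + 1 + (2 * (suc tq + M) + A)
                                 ≡ Q + ((suc tq + M + X) + (suc t + (M + A) + Y)) + tq + 3
    regroup = solve-∀

⌈[n∸1]/2⌉≤t⇒n≤1+2t : ∀ n t → ⌈ (n ∸ 1) /2⌉ ≤ t → n ≤ suc (t + t)
⌈[n∸1]/2⌉≤t⇒n≤1+2t n t ⌈[n∸1]/2⌉≤t = begin
  n                                  ≤⟨ m≤n+m∸n n 1 ⟩
  suc (n ∸ 1)                        ≡⟨ cong suc (⌊n/2⌋+⌈n/2⌉≡n (n ∸ 1)) ⟨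
  suc (⌊ n ∸ 1 /2⌋ + ⌈ n ∸ 1 /2⌉)    ≤⟨ s≤s (+-mono-≤ (≤-trans (⌊n/2⌋≤⌈n/2⌉ (n ∸ 1)) ⌈[n∸1]/2⌉≤t) ⌈[n∸1]/2⌉≤t) ⟩
  suc (t + t)                        ∎
  where open ≤-Reasoning

open import Data.Integer using (ℤ; +_) renaming (_+_ to _+ℤ_; _-_ to _-ℤ_; _*_ to _*ℤ_)
open import Data.Integer.Properties using (pos-*)
import Data.Integer.Tactic.RingSolver as ℤ-Solver

ℕ-identity⇒ℤ : ∀ g c a x y → g + 1 + (2 * c + a) ≡ x + y + 3 →
               (+ g) +ℤ + 1 ≡ + x +ℤ + y -ℤ (+ 2) *ℤ (+ c) -ℤ + a +ℤ + 3
ℕ-identity⇒ℤ g c a x y eq = begin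
  + g +ℤ + 1                                  ≡⟨ cancel (+ g +ℤ + 1) u ⟩
  (+ g +ℤ + 1 +ℤ u) -ℤ u                      ≡⟨ cong (λ v → (+ g +ℤ + 1 +ℤ (v +ℤ + a)) -ℤ u) (pos-* 2 c) ⟨
  + (g + 1 + (2 * c + a)) -ℤ u                ≡⟨ cong (λ m → + m -ℤ u) eq ⟩
  + (x + y + 3) -ℤ u                          ≡⟨ expand (+ x) (+ y) (+ 2) (+ c) (+ a) (+ 3) ⟩
  + x +ℤ + y -ℤ (+ 2) *ℤ (+ c) -ℤ + a +ℤ + 3  ∎
  where
  open ≡-Reasoning
  u = + 2 *ℤ + c +ℤ + a
  cancel : ∀ v w → v ≡ (v +ℤ w) -ℤ w
  cancel = ℤ-Solver.solve-∀
  expand : ∀ x y two c a three → (x +ℤ y +ℤ three) -ℤ (two *ℤ c +ℤ a) ≡ x +ℤ y -ℤ two *ℤ c -ℤ a +ℤ three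
  expand = ℤ-Solver.solve-∀

corollary4p3 : (q n t : ℕ) → .{{_ : NonZero q}} → 2 ≤ q → ⌈ (n ∸ 1) /2⌉ ≤ t → t < n →
    ∃[ g ] ∃[ a ] (HasSize (InGM q n t) g × HasSize (InA q n t) a ×
      ((+ g) +ℤ + 1 ≡ + (q * n) +ℤ + (t / q) -ℤ (+ 2) *ℤ (+ ⌈ n / q ⌉) -ℤ + a +ℤ + 3))
corollary4p3 q n t 2≤q ⌈[n∸1]/2⌉≤t t<n =
  count InGM′? 0 bound , count InA? 0 n ,
  HasSize-resp (λ z → ⇔-sym (InGM⇔InGM′ z)) (count-hasSize InGM′? bound InGM′⇒<bound) ,
  count-hasSize InA? n InA⇒k<n ,
  ℕ-identity⇒ℤ _ ⌈ n / q ⌉ _ (q * n) (t / q) gap-count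
  where open GapCount q n t 2≤q (⌈[n∸1]/2⌉≤t⇒n≤1+2t n t ⌈[n∸1]/2⌉≤t) t<n
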